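{- For every integer $n\geq 1$ and all $a,b\in\mathbb{C}$, $$\sum_{P}a^{\,n-\mathrm{enor}(P)}b^{\,\mathrm{enor}(P)}=\sum_{P}a^{\,n-\mathrm{valley}(P)}b^{\,\mathrm{valley}(P)},$$ where both sums range over all Catalan paths $P$ of order $n$; i.e. $\mathcal{C}_n^{(a,b)}=C_n^{(a,b)}$.
   Context: A Catalan path of order $n$ is a word $P=p_1p_2\cdots p_{2n}$ in the letters $\mathbf{N}$ and $\mathbf{E}$ with exactly $n$ of each letter such that every prefix contains at least as many $\mathbf{N}$'s as $\mathbf{E}$'s. $\mathrm{valley}(P)$ is the number of indices $i$ with $p_i=\mathbf{E}$ and $p_{i+1}=\mathbf{N}$. $\mathrm{enor}(P)$ is the number of indices $i\in\{1,\dots,n\}$ with $p_{2i}=\mathbf{N}$ (north steps in even positions). $\mathcal{C}_n^{(a,b)}$ and $C_n^{(a,b)}$ denote the left and right sums respectively. -}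

module Defs where

open import Level using (Level)
open import Data.Bool using (_≟_)
open import Data.Bool using (Bool; true; false; _∧_; if_then_else_)
open import Data.Nat using (ℕ; zero; suc; _≡ᵇ_; _≤ᵇ_)
import Data.Nat as ℕ
open import Data.List using (List; []; _∷_; _++_; map; filter; length; inits; foldr)
open import Data.List.Relation.Unary.All using (All)
open import Relation.Binary.PropositionalEquality using (_≡_)
open import Algebra.Bundles using (CommutativeRing)

data Step : Set where
  N E : Step

isN : Step → Bool
isN N = true
isN E = false

isE : Step → Bool
isE N = false
isE E = true

countN : List Step → ℕ
countN [] = 0
countN (s ∷ w) = (if isN s then 1 else 0) ℕ.+ countN w

countE : List Step → ℕ
countE [] = 0
countE (s ∷ w) = (if isE s then 1 else 0) ℕ.+ countE w

words : ℕ → List (List Step)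
words zero = [] ∷ []
words (suc k) = map (N ∷_) (words k) ++ map (E ∷_) (words k)

allBool : {A : Set} → (A → Bool) → List A → Bool
allBool p [] = true
allBool p (x ∷ xs) = p x ∧ allBool p xs

isCatalan : ℕ → List Step → Bool
isCatalan n w =
  (countN w ≡ᵇ n) ∧ (countE w ≡ᵇ n) ∧ allBool (λ u → countE u ≤ᵇ countN u) (inits w)

catalanPaths : ℕ → List (List Step)
catalanPaths n = filter (λ w → isCatalan n w ≟ true) (words (2 ℕ.* n))

valley : List Step → ℕ
valley [] = 0
valley (E ∷ N ∷ w) = suc (valley (N ∷ w))
valley (_ ∷ w) = valley w

-- enor(P): number of i with p_{2i} = N (1-indexed positions)
enor : List Step → ℕ
enor [] = 0
enor (_ ∷ []) = 0
enor (_ ∷ y ∷ w) = (if isN y then 1 else 0) ℕ.+ enor w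

module _ {c ℓ : Level} (R : CommutativeRing c ℓ) where
  open CommutativeRing R

  pow : Carrier → ℕ → Carrier
  pow x zero = 1#
  pow x (suc k) = x * pow x k

  sumR : List Carrier → Carrier
  sumR = foldr _+_ 0#

  leftSum : ℕ → Carrier → Carrier → Carrier
  leftSum n a b = sumR (map (λ P → pow a (n ℕ.∸ enor P) * pow b (enor P)) (catalanPaths n))

  rightSum : ℕ → Carrier → Carrier → Carrier
  rightSum n a b = sumR (map (λ P → pow a (n ℕ.∸ valley P) * pow b (valley P)) (catalanPaths n))

-- A nonempty Dyck path is an arch N A E B with A and B Dyck paths. Since A has even length,
--   enor (N A E B)     = enor (E A) + enor B,        enor (E N A E B)   = 1 + enor A + enor (E B),
--   valley (N A E B)   = valley A + valley (E B),    valley (E N A E B) = 1 + valley A + valley (E B).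
-- Hence, by strong induction on the length, enor and valley are equidistributed over Dyck paths jointly
-- with their values on E-prefixed paths; comparing enor with valley exchanges the roles of A and B, which
-- is harmless as (A, B) runs over all pairs of Dyck paths of complementary lengths. Equidistribution is a
-- permutation between the lists of values, and both sums depend only on these lists. The arch
-- decomposition comes from splitting a path that starts at height h + 1 at its first visit to h.
module Submission where

open import Defs
open import Level using (Level)
open import Algebra.Bundles using (CommutativeMonoid; CommutativeRing)
open import Data.Bool as Bool using (Bool; true; false; _∧_)
import Data.Bool.Properties as Boolₚ
open import Data.Nat as ℕ using (ℕ; zero; suc; _+_; _*_; _∸_; _≤_; _<_; _≡ᵇ_; _≤ᵇ_; s≤s; parity)
open import Data.Nat.Induction using (<-rec)
import Data.Nat.Properties as ℕₚ
open import Data.Parity.Base using (0ℙ)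
import Data.Parity.Properties as Parityₚ
open import Data.Product using (_×_; _,_; proj₁; proj₂)
open import Data.List using (List; []; _∷_; [_]; _++_; map; filter; length; inits; cartesianProductWith)
import Data.List.Properties as Listₚ
open import Data.List.Relation.Unary.All as All using (All; []; _∷_)
import Data.List.Relation.Unary.All.Properties as Allₚ
open import Data.List.Relation.Binary.Permutation.Propositional
  using (_↭_; ↭-refl; ↭-sym; ↭-trans; ↭-reflexive; ↭⇒↭ₛ′; module PermutationReasoning)
open import Data.List.Relation.Binary.Permutation.Propositional.Properties
  using (++⁺; ++⁺ˡ; map⁺; ++-comm; shifts; ++-commutativeMonoid)
import Data.List.Relation.Binary.Permutation.Setoid.Properties as SetoidPermutationₚ
open import Function using (_∘_; flip)
open import Relation.Binary.PropositionalEquality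
  using (_≡_; _≢_; refl; sym; trans; cong; cong₂; subst; module ≡-Reasoning)
open import Relation.Nullary using (Dec; yes; no)
open import Relation.Nullary.Decidable using (dec-true; dec-false)

private
  variable
    a b c d : Level
    A : Set a
    B : Set b
    C : Set c
    D : Set d

++-interchange : (ws xs ys zs : List A) → (ws ++ xs) ++ (ys ++ zs) ↭ (ws ++ ys) ++ (xs ++ zs)
++-interchange ws xs ys zs = interchange ws xs ys zs
  where
  open import Algebra.Properties.CommutativeSemigroup
    (CommutativeMonoid.commutativeSemigroup ++-commutativeMonoid)

filter-map : ∀ {p : B → Bool} {q : A → Bool} (f : A → B) → (∀ x → p (f x) ≡ q x) → ∀ xs →
             filter (λ y → p y Bool.≟ true) (map f xs) ≡ map f (filter (λ x → q x Bool.≟ true) xs)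
filter-map f p∘f≗q []       = refl
filter-map {q = q} f p∘f≗q (x ∷ xs) rewrite p∘f≗q x with q x
... | true  = cong (f x ∷_) (filter-map f p∘f≗q xs)
... | false = filter-map f p∘f≗q xs

filter-cong-local : ∀ {p q : A → Bool} {xs} → All (λ x → p x ≡ q x) xs →
                    filter (λ x → p x Bool.≟ true) xs ≡ filter (λ x → q x Bool.≟ true) xs
filter-cong-local []                 = refl
filter-cong-local {q = q} {x ∷ _} (px≡qx ∷ eqs) rewrite px≡qx with q x
... | true  = cong (x ∷_) (filter-cong-local eqs)
... | false = filter-cong-local eqs

cartesianProductWith-congʳ : ∀ (f : A → B → C) xs {ys ys′} → ys ↭ ys′ →
                             cartesianProductWith f xs ys ↭ cartesianProductWith f xs ys′
cartesianProductWith-congʳ f []       ys↭ys′ = ↭-refl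
cartesianProductWith-congʳ f (x ∷ xs) ys↭ys′ =
  ++⁺ (map⁺ (f x) ys↭ys′) (cartesianProductWith-congʳ f xs ys↭ys′)

cartesianProductWith-consʳ : ∀ (f : A → B → C) xs y ys →
  cartesianProductWith f xs (y ∷ ys) ↭ map (λ x → f x y) xs ++ cartesianProductWith f xs ys
cartesianProductWith-consʳ f []       y ys = ↭-refl
cartesianProductWith-consʳ f (x ∷ xs) y ys = begin
  f x y ∷ map (f x) ys ++ cartesianProductWith f xs (y ∷ ys)
    <⟨ ++⁺ˡ (map (f x) ys) (cartesianProductWith-consʳ f xs y ys) ⟩
  f x y ∷ map (f x) ys ++ map (λ x → f x y) xs ++ cartesianProductWith f xs ys
    <⟨ shifts (map (f x) ys) (map (λ x → f x y) xs) ⟩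
  f x y ∷ map (λ x → f x y) xs ++ map (f x) ys ++ cartesianProductWith f xs ys ∎
  where open PermutationReasoning

cartesianProductWith-comm : ∀ (f : A → B → C) xs ys →
  cartesianProductWith f xs ys ↭ cartesianProductWith (flip f) ys xs
cartesianProductWith-comm f []       ys = ↭-reflexive (sym (Listₚ.cartesianProductWith-zeroʳ (flip f) ys))
cartesianProductWith-comm f (x ∷ xs) ys = ↭-trans
  (++⁺ˡ (map (f x) ys) (cartesianProductWith-comm f xs ys))
  (↭-sym (cartesianProductWith-consʳ (flip f) ys x xs))

cartesianProductWith-cong : ∀ (f : A → B → C) {xs xs′ ys ys′} → xs ↭ xs′ → ys ↭ ys′ →
  cartesianProductWith f xs ys ↭ cartesianProductWith f xs′ ys′
cartesianProductWith-cong f {xs} {xs′} {ys} {ys′} xs↭xs′ ys↭ys′ = begin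
  cartesianProductWith f xs ys          ↭⟨ cartesianProductWith-congʳ f xs ys↭ys′ ⟩
  cartesianProductWith f xs ys′         ↭⟨ cartesianProductWith-comm f xs ys′ ⟩
  cartesianProductWith (flip f) ys′ xs  ↭⟨ cartesianProductWith-congʳ (flip f) ys′ xs↭xs′ ⟩
  cartesianProductWith (flip f) ys′ xs′ ↭⟨ cartesianProductWith-comm (flip f) ys′ xs′ ⟩
  cartesianProductWith f xs′ ys′        ∎
  where open PermutationReasoning

map-cartesianProductWith : ∀ (g : C → D) (f : A → B → C) xs ys →
  map g (cartesianProductWith f xs ys) ≡ cartesianProductWith (λ x y → g (f x y)) xs ys
map-cartesianProductWith g f []       ys = refl
map-cartesianProductWith g f (x ∷ xs) ys = begin
  map g (map (f x) ys ++ cartesianProductWith f xs ys)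
    ≡⟨ Listₚ.map-++ g (map (f x) ys) _ ⟩
  map g (map (f x) ys) ++ map g (cartesianProductWith f xs ys)
    ≡⟨ cong₂ _++_ (sym (Listₚ.map-∘ ys)) (map-cartesianProductWith g f xs ys) ⟩
  map (λ y → g (f x y)) ys ++ cartesianProductWith (λ x y → g (f x y)) xs ys ∎
  where open ≡-Reasoning

cartesianProductWith-mapˡ : ∀ (f : B → C → D) (g : A → B) xs ys →
  cartesianProductWith f (map g xs) ys ≡ cartesianProductWith (λ x → f (g x)) xs ys
cartesianProductWith-mapˡ f g []       ys = refl
cartesianProductWith-mapˡ f g (x ∷ xs) ys = cong (map (f (g x)) ys ++_) (cartesianProductWith-mapˡ f g xs ys)

cartesianProductWith-mapʳ : ∀ (f : A → C → D) (g : B → C) xs ys →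
  cartesianProductWith f xs (map g ys) ≡ cartesianProductWith (λ x y → f x (g y)) xs ys
cartesianProductWith-mapʳ f g []       ys = refl
cartesianProductWith-mapʳ f g (x ∷ xs) ys =
  cong₂ _++_ (sym (Listₚ.map-∘ ys)) (cartesianProductWith-mapʳ f g xs ys)

cartesianProductWith-cong-local : ∀ {f g : A → B → C} {xs} → All (λ x → ∀ y → f x y ≡ g x y) xs →
  ∀ ys → cartesianProductWith f xs ys ≡ cartesianProductWith g xs ys
cartesianProductWith-cong-local []           ys = refl
cartesianProductWith-cong-local (fx≗gx ∷ eqs) ys =
  cong₂ _++_ (Listₚ.map-cong fx≗gx ys) (cartesianProductWith-cong-local eqs ys)

cartesianProductWith-assoc : ∀ {u v} {U : Set u} {V : Set v}
  (f : A → U → D) (g : B → C → U) (h : V → C → D) (k : A → B → V) →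
  (∀ x y z → f x (g y z) ≡ h (k x y) z) → ∀ xs ys zs →
  cartesianProductWith f xs (cartesianProductWith g ys zs) ≡
  cartesianProductWith h (cartesianProductWith k xs ys) zs
cartesianProductWith-assoc f g h k law []       ys zs = refl
cartesianProductWith-assoc f g h k law (x ∷ xs) ys zs = begin
  map (f x) (cartesianProductWith g ys zs) ++ cartesianProductWith f xs (cartesianProductWith g ys zs)
    ≡⟨ cong₂ _++_ (map-cartesianProductWith (f x) g ys zs) (cartesianProductWith-assoc f g h k law xs ys zs) ⟩
  cartesianProductWith (λ y z → f x (g y z)) ys zs ++ cartesianProductWith h (cartesianProductWith k xs ys) zs
    ≡⟨ cong (_++ _) (cartesianProductWith-cong-local (All.universal (λ y z → law x y z) ys) zs) ⟩
  cartesianProductWith (λ y z → h (k x y) z) ys zs ++ cartesianProductWith h (cartesianProductWith k xs ys) zs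
    ≡⟨ cong (_++ _) (cartesianProductWith-mapˡ h (k x) ys zs) ⟨
  cartesianProductWith h (map (k x) ys) zs ++ cartesianProductWith h (cartesianProductWith k xs ys) zs
    ≡⟨ Listₚ.cartesianProductWith-distribʳ-++ h (map (k x) ys) _ zs ⟨
  cartesianProductWith h (map (k x) ys ++ cartesianProductWith k xs ys) zs ∎
  where open ≡-Reasoning

-- conv m T concatenates the T j k over j + k + 1 ≡ m: two pieces of a path of length m joined by one step.
conv : ℕ → (ℕ → ℕ → List A) → List A
conv zero    T = []
conv (suc m) T = T 0 m ++ conv m (λ j → T (suc j))

split-<ˡ : ∀ j k {m} → suc (j + k) ≡ m → j < m
split-<ˡ j k refl = s≤s (ℕₚ.m≤m+n j k)

split-<ʳ : ∀ j k {m} → suc (j + k) ≡ m → k < m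
split-<ʳ j k refl = s≤s (ℕₚ.m≤n+m k j)

conv-cong : ∀ m {T U : ℕ → ℕ → List A} → (∀ j k → suc (j + k) ≡ m → T j k ↭ U j k) →
            conv m T ↭ conv m U
conv-cong zero    T↭U = ↭-refl
conv-cong (suc m) T↭U = ++⁺ (T↭U 0 m refl) (conv-cong m (λ j k eq → T↭U (suc j) k (cong suc eq)))

map-conv : ∀ (f : A → B) m (T : ℕ → ℕ → List A) → map f (conv m T) ≡ conv m (λ j k → map f (T j k))
map-conv f zero    T = refl
map-conv f (suc m) T = trans (Listₚ.map-++ f (T 0 m) _) (cong (map f (T 0 m) ++_) (map-conv f m _))

conv-++ : ∀ m (T U : ℕ → ℕ → List A) → conv m (λ j k → T j k ++ U j k) ↭ conv m T ++ conv m U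
conv-++ zero    T U = ↭-refl
conv-++ (suc m) T U = ↭-trans (++⁺ˡ (T 0 m ++ U 0 m) (conv-++ m (λ j → T (suc j)) (λ j → U (suc j))))
                              (++-interchange (T 0 m) (U 0 m) _ _)

conv-sucʳ : ∀ m (T : ℕ → ℕ → List A) → conv (suc m) T ≡ conv m (λ j k → T j (suc k)) ++ T m 0
conv-sucʳ zero    T = Listₚ.++-identityʳ (T 0 0)
conv-sucʳ (suc m) T = trans (cong (T 0 (suc m) ++_) (conv-sucʳ m (λ j → T (suc j))))
                            (sym (Listₚ.++-assoc (T 0 (suc m)) _ _))

conv-flip : ∀ m (T : ℕ → ℕ → List A) → conv m T ↭ conv m (flip T)
conv-flip zero    T = ↭-refl
conv-flip (suc m) T = begin
  T 0 m ++ conv m (λ j → T (suc j))          ↭⟨ ++⁺ˡ (T 0 m) (conv-flip m (λ j → T (suc j))) ⟩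
  T 0 m ++ conv m (λ j k → T (suc k) j)      ↭⟨ ++-comm (T 0 m) _ ⟩
  conv m (λ j k → T (suc k) j) ++ T 0 m      ≡⟨ conv-sucʳ m (flip T) ⟨
  conv (suc m) (flip T)                      ∎
  where open PermutationReasoning

conv-assoc : ∀ m (T : ℕ → ℕ → ℕ → List A) →
             conv m (λ j k → conv k (T j)) ↭ conv m (λ j k → conv j (λ a b → T a b k))
conv-assoc zero    T = ↭-refl
conv-assoc (suc m) T = ↭-trans (++⁺ˡ (conv m (T 0)) (conv-assoc m (λ j → T (suc j))))
                               (↭-sym (conv-++ m (T 0) _))

cartesianProductWith-convˡ : ∀ (f : A → B → C) m (T : ℕ → ℕ → List A) ys →
  cartesianProductWith f (conv m T) ys ≡ conv m (λ j k → cartesianProductWith f (T j k) ys)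
cartesianProductWith-convˡ f zero    T ys = refl
cartesianProductWith-convˡ f (suc m) T ys =
  trans (Listₚ.cartesianProductWith-distribʳ-++ f (T 0 m) _ ys)
        (cong (cartesianProductWith f (T 0 m) ys ++_) (cartesianProductWith-convˡ f m _ ys))

cartesianProductWith-convʳ : ∀ (f : A → B → C) xs m (T : ℕ → ℕ → List B) →
  cartesianProductWith f xs (conv m T) ↭ conv m (λ j k → cartesianProductWith f xs (T j k))
cartesianProductWith-convʳ f xs m T = begin
  cartesianProductWith f xs (conv m T)
    ↭⟨ cartesianProductWith-comm f xs (conv m T) ⟩
  cartesianProductWith (flip f) (conv m T) xs
    ≡⟨ cartesianProductWith-convˡ (flip f) m T xs ⟩
  conv m (λ j k → cartesianProductWith (flip f) (T j k) xs)
    ↭⟨ conv-cong m (λ j k _ → cartesianProductWith-comm (flip f) (T j k) xs) ⟩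
  conv m (λ j k → cartesianProductWith f xs (T j k)) ∎
  where open PermutationReasoning

EquidistributedOn : List A → (A → ℕ) → (A → ℕ) → Set
EquidistributedOn xs s t = map s xs ↭ map t xs

conv-equidistributed : ∀ m (_⊕_ : ℕ → ℕ → ℕ) (F G : ℕ → List A) {s₁ t₁ s₂ t₂ : A → ℕ} →
  (∀ {j} → j < m → EquidistributedOn (F j) s₁ t₁) → (∀ {k} → k < m → EquidistributedOn (G k) s₂ t₂) →
  conv m (λ j k → cartesianProductWith _⊕_ (map s₁ (F j)) (map s₂ (G k))) ↭
  conv m (λ j k → cartesianProductWith _⊕_ (map t₁ (F j)) (map t₂ (G k)))
conv-equidistributed m _⊕_ F G s₁~t₁ s₂~t₂ = conv-cong m λ j k jk →
  cartesianProductWith-cong _⊕_ (s₁~t₁ (split-<ˡ j k jk)) (s₂~t₂ (split-<ʳ j k jk))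

module _ {c ℓ} (R : CommutativeRing c ℓ) where
  open CommutativeRing R

  sumR-equidistributed : ∀ (F : ℕ → Carrier) {xs : List A} {s t : A → ℕ} → EquidistributedOn xs s t →
                         sumR R (map (F ∘ s) xs) ≈ sumR R (map (F ∘ t) xs)
  sumR-equidistributed F {xs} {s} {t} s~t = begin
    sumR R (map (F ∘ s) xs)    ≡⟨ cong (sumR R) (Listₚ.map-∘ xs) ⟩
    sumR R (map F (map s xs))  ≈⟨ foldr-commMonoid +-isCommutativeMonoid (↭⇒↭ₛ′ isEquivalence (map⁺ F s~t)) ⟩
    sumR R (map F (map t xs))  ≡⟨ cong (sumR R) (Listₚ.map-∘ xs) ⟨
    sumR R (map (F ∘ t) xs)    ∎
    where
    open import Relation.Binary.Reasoning.Setoid setoid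
    open SetoidPermutationₚ setoid using (foldr-commMonoid)

Word : Set
Word = List Step

-- The words of length m that go from height h down to height 0 without going below 0.
paths : ℕ → ℕ → List Word
paths zero    zero    = [ [] ]
paths zero    (suc h) = []
paths (suc m) zero    = map (N ∷_) (paths m 1)
paths (suc m) (suc h) = map (N ∷_) (paths m (suc (suc h))) ++ map (E ∷_) (paths m h)

dyck : ℕ → List Word
dyck m = paths m 0

isPath : ℕ → Word → Bool
isPath h w = allBool (λ u → countE u ≤ᵇ h + countN u) (inits w) ∧ (countE w ≡ᵇ h + countN w)

allBool-map : ∀ (p : B → Bool) {q : A → Bool} (f : A → B) → (∀ x → p (f x) ≡ q x) →
              ∀ xs → allBool p (map f xs) ≡ allBool q xs
allBool-map p f p∘f≗q []       = refl
allBool-map p f p∘f≗q (x ∷ xs) = cong₂ _∧_ (p∘f≗q x) (allBool-map p f p∘f≗q xs)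

suc-≤ᵇ-suc : ∀ m n → (suc m ≤ᵇ suc n) ≡ (m ≤ᵇ n)
suc-≤ᵇ-suc zero    n = refl
suc-≤ᵇ-suc (suc m) n = refl

isPath-N : ∀ h w → isPath h (N ∷ w) ≡ isPath (suc h) w
isPath-N h w = cong₂ _∧_
  (allBool-map (λ u → countE u ≤ᵇ h + countN u) (N ∷_) (λ u → cong (countE u ≤ᵇ_) (ℕₚ.+-suc h (countN u))) (inits w))
  (cong (countE w ≡ᵇ_) (ℕₚ.+-suc h (countN w)))

isPath-E : ∀ h w → isPath (suc h) (E ∷ w) ≡ isPath h w
isPath-E h w = cong (_∧ (countE w ≡ᵇ h + countN w))
  (allBool-map (λ u → countE u ≤ᵇ suc h + countN u) (E ∷_) (λ u → suc-≤ᵇ-suc (countE u) (h + countN u)) (inits w))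

isPath? : ∀ h (w : Word) → Dec (isPath h w ≡ true)
isPath? h w = isPath h w Bool.≟ true

filter-isPath-words : ∀ m h → filter (isPath? h) (words m) ≡ paths m h
filter-isPath-words zero    zero    = refl
filter-isPath-words zero    (suc h) = refl
filter-isPath-words (suc m) zero    = begin
  filter (isPath? 0) (map (N ∷_) (words m) ++ map (E ∷_) (words m))
    ≡⟨ Listₚ.filter-++ (isPath? 0) (map (N ∷_) (words m)) _ ⟩
  filter (isPath? 0) (map (N ∷_) (words m)) ++ filter (isPath? 0) (map (E ∷_) (words m))
    ≡⟨ cong₂ _++_ (filter-map (N ∷_) (isPath-N 0) (words m))
                  (Listₚ.filter-none (isPath? 0) (Allₚ.map⁺ (All.universal (λ _ ()) (words m)))) ⟩
  map (N ∷_) (filter (isPath? 1) (words m)) ++ []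
    ≡⟨ Listₚ.++-identityʳ _ ⟩
  map (N ∷_) (filter (isPath? 1) (words m))
    ≡⟨ cong (map (N ∷_)) (filter-isPath-words m 1) ⟩
  map (N ∷_) (paths m 1) ∎
  where open ≡-Reasoning
filter-isPath-words (suc m) (suc h) = begin
  filter (isPath? (suc h)) (map (N ∷_) (words m) ++ map (E ∷_) (words m))
    ≡⟨ Listₚ.filter-++ (isPath? (suc h)) (map (N ∷_) (words m)) _ ⟩
  filter (isPath? (suc h)) (map (N ∷_) (words m)) ++ filter (isPath? (suc h)) (map (E ∷_) (words m))
    ≡⟨ cong₂ _++_ (filter-map (N ∷_) (isPath-N (suc h)) (words m)) (filter-map (E ∷_) (isPath-E h) (words m)) ⟩
  map (N ∷_) (filter (isPath? (suc (suc h))) (words m)) ++ map (E ∷_) (filter (isPath? h) (words m))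
    ≡⟨ cong₂ (λ ws ws′ → map (N ∷_) ws ++ map (E ∷_) ws′)
             (filter-isPath-words m (suc (suc h))) (filter-isPath-words m h) ⟩
  map (N ∷_) (paths m (suc (suc h))) ++ map (E ∷_) (paths m h) ∎
  where open ≡-Reasoning

words-length : ∀ m → All (λ w → length w ≡ m) (words m)
words-length zero    = refl ∷ []
words-length (suc m) = Allₚ.++⁺ (Allₚ.map⁺ (All.map (cong suc) (words-length m)))
                                (Allₚ.map⁺ (All.map (cong suc) (words-length m)))

countN+countE≡length : ∀ w → countN w + countE w ≡ length w
countN+countE≡length []      = refl
countN+countE≡length (N ∷ w) = cong suc (countN+countE≡length w)
countN+countE≡length (E ∷ w) = trans (ℕₚ.+-suc (countN w) (countE w)) (cong suc (countN+countE≡length w))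

≡ᵇ-balanced : ∀ p q n → p + q ≡ 2 * n → ((p ≡ᵇ n) ∧ (q ≡ᵇ n)) ≡ (q ≡ᵇ p)
≡ᵇ-balanced p q n p+q≡2n with p ℕ.≟ n
... | yes refl rewrite dec-true (p ℕ.≟ p) refl = refl
... | no p≢n   rewrite dec-false (p ℕ.≟ n) p≢n = sym (dec-false (q ℕ.≟ p) q≢p)
  where
  q≢p : q ≢ p
  q≢p refl = p≢n (ℕₚ.*-cancelˡ-≡ p n 2 (trans (cong (p +_) (ℕₚ.+-identityʳ p)) p+q≡2n))

isCatalan≡isPath : ∀ n {w} → length w ≡ 2 * n → isCatalan n w ≡ isPath 0 w
isCatalan≡isPath n {w} length≡2n = begin
  (countN w ≡ᵇ n) ∧ (countE w ≡ᵇ n) ∧ prefixes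
    ≡⟨ Boolₚ.∧-assoc (countN w ≡ᵇ n) _ _ ⟨
  ((countN w ≡ᵇ n) ∧ (countE w ≡ᵇ n)) ∧ prefixes
    ≡⟨ cong (_∧ prefixes) (≡ᵇ-balanced (countN w) (countE w) n (trans (countN+countE≡length w) length≡2n)) ⟩
  (countE w ≡ᵇ countN w) ∧ prefixes
    ≡⟨ Boolₚ.∧-comm _ prefixes ⟩
  prefixes ∧ (countE w ≡ᵇ countN w) ∎
  where
  open ≡-Reasoning
  prefixes = allBool (λ u → countE u ≤ᵇ countN u) (inits w)

catalanPaths≡paths : ∀ n → catalanPaths n ≡ dyck (2 * n)
catalanPaths≡paths n = trans (filter-cong-local (All.map (λ {w} → isCatalan≡isPath n {w}) (words-length (2 * n))))
                             (filter-isPath-words (2 * n) 0)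

infixr 5 _⋆_
_⋆_ : List Word → List Word → List Word
xs ⋆ ys = cartesianProductWith (λ x y → x ++ E ∷ y) xs ys

arch : Word → Word → Word
arch A B = N ∷ A ++ E ∷ B

⋆-assoc : ∀ xs ys zs → xs ⋆ (ys ⋆ zs) ≡ (xs ⋆ ys) ⋆ zs
⋆-assoc = cartesianProductWith-assoc _ _ _ _ (λ x y z → sym (Listₚ.++-assoc x (E ∷ y) (E ∷ z)))

map-N-⋆ : ∀ xs ys → map (N ∷_) (xs ⋆ ys) ≡ cartesianProductWith arch xs ys
map-N-⋆ = map-cartesianProductWith (N ∷_) _

-- Split a path from height h + 1 at its first visit to h.
firstPassage : ∀ m h → paths m (suc h) ↭ conv m (λ j k → dyck j ⋆ paths k h)
firstPassage = <-rec _ passage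
  where
  passage : ∀ m → (∀ {m′} → m′ < m → ∀ h → paths m′ (suc h) ↭ conv m′ (λ j k → dyck j ⋆ paths k h)) →
            ∀ h → paths m (suc h) ↭ conv m (λ j k → dyck j ⋆ paths k h)
  passage zero    _   h = ↭-refl
  passage (suc m) rec h = begin
    map (N ∷_) (paths m (suc (suc h))) ++ map (E ∷_) (paths m h)
      ↭⟨ ++-comm (map (N ∷_) (paths m (suc (suc h)))) _ ⟩
    map (E ∷_) (paths m h) ++ map (N ∷_) (paths m (suc (suc h)))
      ↭⟨ ++⁺ (↭-reflexive (sym (Listₚ.++-identityʳ _))) N-first ⟩
    conv (suc m) (λ j k → dyck j ⋆ paths k h) ∎
    where
    open PermutationReasoning
    rec′ : ∀ {m′} → m′ < m → ∀ h → paths m′ (suc h) ↭ conv m′ (λ j k → dyck j ⋆ paths k h)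
    rec′ m′<m = rec (ℕₚ.m<n⇒m<1+n m′<m)

    -- Split at the first visits to h + 1 and to h, then regroup the first two pieces into a path from 1 to 0.
    twoPassages : paths m (suc (suc h)) ↭ conv m (λ j k → paths j 1 ⋆ paths k h)
    twoPassages = begin
      paths m (suc (suc h))
        ↭⟨ rec (ℕₚ.n<1+n m) (suc h) ⟩
      conv m (λ j k → dyck j ⋆ paths k (suc h))
        ↭⟨ conv-cong m (λ j k jk → cartesianProductWith-congʳ _ (dyck j) (rec′ (split-<ʳ j k jk) h)) ⟩
      conv m (λ j k → dyck j ⋆ conv k (λ b c → dyck b ⋆ paths c h))
        ↭⟨ conv-cong m (λ j k _ → cartesianProductWith-convʳ _ (dyck j) k _) ⟩
      conv m (λ j k → conv k (λ b c → dyck j ⋆ dyck b ⋆ paths c h))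
        ↭⟨ conv-cong m (λ j k _ → conv-cong k (λ b c _ → ↭-reflexive (⋆-assoc (dyck j) (dyck b) (paths c h)))) ⟩
      conv m (λ j k → conv k (λ b c → (dyck j ⋆ dyck b) ⋆ paths c h))
        ↭⟨ conv-assoc m (λ a b c → (dyck a ⋆ dyck b) ⋆ paths c h) ⟩
      conv m (λ j k → conv j (λ a b → (dyck a ⋆ dyck b) ⋆ paths k h))
        ↭⟨ conv-cong m (λ j k _ → ↭-reflexive (sym (cartesianProductWith-convˡ _ j _ (paths k h)))) ⟩
      conv m (λ j k → conv j (λ a b → dyck a ⋆ dyck b) ⋆ paths k h)
        ↭⟨ conv-cong m (λ j k jk → cartesianProductWith-cong _ (rec′ (split-<ˡ j k jk) 0) ↭-refl) ⟨
      conv m (λ j k → paths j 1 ⋆ paths k h) ∎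

    N-first : map (N ∷_) (paths m (suc (suc h))) ↭ conv m (λ j k → dyck (suc j) ⋆ paths k h)
    N-first = begin
      map (N ∷_) (paths m (suc (suc h)))
        ↭⟨ map⁺ (N ∷_) twoPassages ⟩
      map (N ∷_) (conv m (λ j k → paths j 1 ⋆ paths k h))
        ≡⟨ map-conv (N ∷_) m _ ⟩
      conv m (λ j k → map (N ∷_) (paths j 1 ⋆ paths k h))
        ↭⟨ conv-cong m (λ j k _ → ↭-reflexive (trans (map-N-⋆ (paths j 1) (paths k h))
                                     (sym (cartesianProductWith-mapˡ _ (N ∷_) (paths j 1) (paths k h))))) ⟩
      conv m (λ j k → dyck (suc j) ⋆ paths k h) ∎

dyck-decomposition : ∀ m → dyck (suc m) ↭ conv m (λ j k → cartesianProductWith arch (dyck j) (dyck k))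
dyck-decomposition m = begin
  map (N ∷_) (paths m 1)                               ↭⟨ map⁺ (N ∷_) (firstPassage m 0) ⟩
  map (N ∷_) (conv m (λ j k → dyck j ⋆ dyck k))  ≡⟨ map-conv (N ∷_) m _ ⟩
  conv m (λ j k → map (N ∷_) (dyck j ⋆ dyck k))  ↭⟨ conv-cong m (λ j k _ → ↭-reflexive (map-N-⋆ (dyck j) (dyck k))) ⟩
  conv m (λ j k → cartesianProductWith arch (dyck j) (dyck k)) ∎
  where open PermutationReasoning

parity-∷ : ∀ x h {ws : List Word} → All (λ w → parity (length w) ≡ parity h) ws →
           All (λ w → parity (length w) ≡ parity (suc h)) (map (x ∷_) ws)
parity-∷ x h = Allₚ.map⁺ ∘ All.map λ {w} eq →
  Parityₚ.⁻¹-injective (trans (Parityₚ.suc-homo-⁻¹ (length w)) (trans eq (sym (Parityₚ.suc-homo-⁻¹ h))))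

paths-parity : ∀ m h → All (λ w → parity (length w) ≡ parity h) (paths m h)
paths-parity zero    zero    = refl ∷ []
paths-parity zero    (suc h) = []
paths-parity (suc m) zero    = parity-∷ N 1 (paths-parity m 1)
paths-parity (suc m) (suc h) = Allₚ.++⁺ (parity-∷ N h (paths-parity m (suc (suc h))))
                                        (parity-∷ E h (paths-parity m h))

enor-head : ∀ x y w → enor (x ∷ w) ≡ enor (y ∷ w)
enor-head x y []      = refl
enor-head x y (_ ∷ w) = refl

enor-++ : ∀ A → parity (length A) ≡ 0ℙ → ∀ w → enor (A ++ w) ≡ enor A + enor w
enor-++ []          _    w = refl
enor-++ (x ∷ y ∷ A) even w = trans (cong (_ +_) (enor-++ A even w)) (sym (ℕₚ.+-assoc _ (enor A) (enor w)))

enor-∷-++ : ∀ x A → parity (length A) ≡ 0ℙ → ∀ y w → enor (x ∷ A ++ w) ≡ enor (x ∷ A) + enor (y ∷ w)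
enor-∷-++ x []          _    y w = enor-head x y w
enor-∷-++ x (a ∷ b ∷ A) even y w =
  trans (cong (_ +_) (enor-∷-++ b A even y w)) (sym (ℕₚ.+-assoc _ (enor (b ∷ A)) (enor (y ∷ w))))

valley-++-E : ∀ A w → valley (A ++ E ∷ w) ≡ valley A + valley (E ∷ w)
valley-++-E []          w = refl
valley-++-E (N ∷ A)     w = valley-++-E A w
valley-++-E (E ∷ [])    w = refl
valley-++-E (E ∷ N ∷ A) w = cong suc (valley-++-E (N ∷ A) w)
valley-++-E (E ∷ E ∷ A) w = valley-++-E (E ∷ A) w

enor-arch : ∀ A → parity (length A) ≡ 0ℙ → ∀ B → enor (arch A B) ≡ enor (E ∷ A) + enor B
enor-arch A even B = trans (enor-∷-++ N A even E (E ∷ B)) (cong (_+ enor B) (enor-head N E A))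

enor-E-arch : ∀ A → parity (length A) ≡ 0ℙ → ∀ B → enor (E ∷ arch A B) ≡ suc (enor A + enor (E ∷ B))
enor-E-arch A even B = cong suc (enor-++ A even (E ∷ B))

valley-arch : ∀ A B → valley (arch A B) ≡ valley A + valley (E ∷ B)
valley-arch = valley-++-E

valley-E-arch : ∀ A B → valley (E ∷ arch A B) ≡ suc (valley A + valley (E ∷ B))
valley-E-arch A B = cong suc (valley-++-E A B)

map-arches : ∀ (s : Word → ℕ) (_⊕_ : ℕ → ℕ → ℕ) (s₁ s₂ : Word → ℕ) →
  (∀ A → parity (length A) ≡ 0ℙ → ∀ B → s (arch A B) ≡ s₁ A ⊕ s₂ B) → ∀ j k →
  map s (cartesianProductWith arch (dyck j) (dyck k)) ≡
  cartesianProductWith _⊕_ (map s₁ (dyck j)) (map s₂ (dyck k))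
map-arches s _⊕_ s₁ s₂ s-arch j k = begin
  map s (cartesianProductWith arch (dyck j) (dyck k))
    ≡⟨ map-cartesianProductWith s arch (dyck j) (dyck k) ⟩
  cartesianProductWith (λ A B → s (arch A B)) (dyck j) (dyck k)
    ≡⟨ cartesianProductWith-cong-local (All.map (λ {A} → s-arch A) (paths-parity j 0)) (dyck k) ⟩
  cartesianProductWith (λ A B → s₁ A ⊕ s₂ B) (dyck j) (dyck k)
    ≡⟨ cartesianProductWith-mapʳ (λ A y → s₁ A ⊕ y) s₂ (dyck j) (dyck k) ⟨
  cartesianProductWith (λ A y → s₁ A ⊕ y) (dyck j) (map s₂ (dyck k))
    ≡⟨ cartesianProductWith-mapˡ _⊕_ s₁ (dyck j) (map s₂ (dyck k)) ⟨
  cartesianProductWith _⊕_ (map s₁ (dyck j)) (map s₂ (dyck k)) ∎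
  where open ≡-Reasoning

map-dyck : ∀ (s : Word → ℕ) (_⊕_ : ℕ → ℕ → ℕ) (s₁ s₂ : Word → ℕ) →
  (∀ A → parity (length A) ≡ 0ℙ → ∀ B → s (arch A B) ≡ s₁ A ⊕ s₂ B) → ∀ m →
  map s (dyck (suc m)) ↭ conv m (λ j k → cartesianProductWith _⊕_ (map s₁ (dyck j)) (map s₂ (dyck k)))
map-dyck s _⊕_ s₁ s₂ s-arch m = begin
  map s (dyck (suc m))
    ↭⟨ map⁺ s (dyck-decomposition m) ⟩
  map s (conv m (λ j k → cartesianProductWith arch (dyck j) (dyck k)))
    ≡⟨ map-conv s m _ ⟩
  conv m (λ j k → map s (cartesianProductWith arch (dyck j) (dyck k)))
    ↭⟨ conv-cong m (λ j k _ → ↭-reflexive (map-arches s _⊕_ s₁ s₂ s-arch j k)) ⟩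
  conv m (λ j k → cartesianProductWith _⊕_ (map s₁ (dyck j)) (map s₂ (dyck k))) ∎
  where open PermutationReasoning

enor-valley-equidistributed : ∀ m → EquidistributedOn (dyck m) enor valley ×
                                    EquidistributedOn (dyck m) (enor ∘ (E ∷_)) (valley ∘ (E ∷_))
enor-valley-equidistributed = <-rec _ step
  where
  step : ∀ m → (∀ {j} → j < m → EquidistributedOn (dyck j) enor valley ×
                                EquidistributedOn (dyck j) (enor ∘ (E ∷_)) (valley ∘ (E ∷_))) →
         EquidistributedOn (dyck m) enor valley × EquidistributedOn (dyck m) (enor ∘ (E ∷_)) (valley ∘ (E ∷_))
  step zero    _   = ↭-refl , ↭-refl
  step (suc m) rec = enor~valley , enorᴱ~valleyᴱ
    where
    open PermutationReasoning
    enor~valley′ : ∀ {j} → j < m → EquidistributedOn (dyck j) enor valley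
    enor~valley′ j<m = proj₁ (rec (ℕₚ.m<n⇒m<1+n j<m))
    enorᴱ~valleyᴱ′ : ∀ {j} → j < m → EquidistributedOn (dyck j) (enor ∘ (E ∷_)) (valley ∘ (E ∷_))
    enorᴱ~valleyᴱ′ j<m = proj₂ (rec (ℕₚ.m<n⇒m<1+n j<m))

    enor~valley : EquidistributedOn (dyck (suc m)) enor valley
    enor~valley = begin
      map enor (dyck (suc m))
        ↭⟨ map-dyck enor _+_ (enor ∘ (E ∷_)) enor enor-arch m ⟩
      conv m (λ j k → cartesianProductWith _+_ (map (enor ∘ (E ∷_)) (dyck j)) (map enor (dyck k)))
        ↭⟨ conv-equidistributed m _+_ dyck dyck enorᴱ~valleyᴱ′ enor~valley′ ⟩
      conv m (λ j k → cartesianProductWith _+_ (map (valley ∘ (E ∷_)) (dyck j)) (map valley (dyck k)))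
        ↭⟨ conv-flip m _ ⟩
      conv m (λ j k → cartesianProductWith _+_ (map (valley ∘ (E ∷_)) (dyck k)) (map valley (dyck j)))
        ↭⟨ conv-cong m (λ j k _ → cartesianProductWith-comm _+_ (map (valley ∘ (E ∷_)) (dyck k)) _) ⟩
      conv m (λ j k → cartesianProductWith (flip _+_) (map valley (dyck j)) (map (valley ∘ (E ∷_)) (dyck k)))
        ↭⟨ map-dyck valley (flip _+_) valley (valley ∘ (E ∷_))
                    (λ A _ B → trans (valley-arch A B) (ℕₚ.+-comm (valley A) _)) m ⟨
      map valley (dyck (suc m)) ∎

    enorᴱ~valleyᴱ : EquidistributedOn (dyck (suc m)) (enor ∘ (E ∷_)) (valley ∘ (E ∷_))
    enorᴱ~valleyᴱ = begin
      map (enor ∘ (E ∷_)) (dyck (suc m))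
        ↭⟨ map-dyck (enor ∘ (E ∷_)) (λ x y → suc (x + y)) enor (enor ∘ (E ∷_)) enor-E-arch m ⟩
      conv m (λ j k → cartesianProductWith (λ x y → suc (x + y)) (map enor (dyck j)) (map (enor ∘ (E ∷_)) (dyck k)))
        ↭⟨ conv-equidistributed m (λ x y → suc (x + y)) dyck dyck enor~valley′ enorᴱ~valleyᴱ′ ⟩
      conv m (λ j k → cartesianProductWith (λ x y → suc (x + y)) (map valley (dyck j)) (map (valley ∘ (E ∷_)) (dyck k)))
        ↭⟨ map-dyck (valley ∘ (E ∷_)) (λ x y → suc (x + y)) valley (valley ∘ (E ∷_)) (λ A _ → valley-E-arch A) m ⟨
      map (valley ∘ (E ∷_)) (dyck (suc m)) ∎

catalan-enor-valley-equidistributed : ∀ n → EquidistributedOn (catalanPaths n) enor valley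
catalan-enor-valley-equidistributed n = subst (λ ws → EquidistributedOn ws enor valley)
  (sym (catalanPaths≡paths n)) (proj₁ (enor-valley-equidistributed (2 * n)))

theorem4p1 : ∀ {c ℓ : Level} (R : CommutativeRing c ℓ) (n : ℕ) → 1 ≤ n →
               (a b : CommutativeRing.Carrier R) →
               CommutativeRing._≈_ R (leftSum R n a b) (rightSum R n a b)
theorem4p1 R n _ a b =
  sumR-equidistributed R (λ k → pow R a (n ∸ k) R.* pow R b k) (catalan-enor-valley-equidistributed n)
  where module R = CommutativeRing R
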